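{- Let $G=(V,E)$ be a simple connected undirected graph and let $w\in V$. Construct a bipartite graph $\hat G=(P\sqcup Q,\hat E)$ as follows. Let $P=V$. For each $u\in V$ let $R(u)=\{r_u^1,\dots,r_u^{|V|-d_G(u)}\}$ be a set of new vertices, and for each edge $e\in E$ let $e^1,e^2$ be two new vertices; put $Q=\{e^j : e\in E,\ j\in\{1,2\}\}\cup\bigcup_{u\in V}R(u)$ (all these new vertices distinct). Let $E'=\{ue^j : e\in E,\ u \text{ an endpoint of } e,\ j\in\{1,2\}\}\cup\{ur : u\in V,\ r\in R(u)\}$, and $\hat E=E'\cup\{wq : q\in Q,\ wq\notin E'\}$. Then the partition completion $C(\hat G)$ is moral.
   Context: $d_G(u)$ is the degree of $u$ in $G$. The partition completion $C(\hat G)$ is obtained from $\hat G$ by adding all edges between distinct vertices of $P$ and all edges between distinct vertices of $Q$. For a directed acyclic graph $D=(V,A)$, its moral graph is the undirected graph on $V$ in which $u\neq v$ are adjacent iff they are adjacent in $D$ or are both parents of a common vertex. An undirected graph is moral if it is the moral graph of some directed acyclic graph. -}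

module Defs where

open import Data.Nat using (ℕ; _∸_)
open import Data.Fin using (Fin; _<_)
open import Data.Fin.Properties using ()
open import Data.Bool using (Bool; true; false)
open import Data.List using (List; length; filterᵇ)
open import Data.List using () renaming (allFin to allFinL)
open import Data.Product using (Σ; Σ-syntax; _×_; _,_)
open import Data.Sum using (_⊎_; inj₁; inj₂)
open import Data.Empty using (⊥)
open import Relation.Nullary using (¬_)
open import Relation.Binary.PropositionalEquality using (_≡_; _≢_)
open import Relation.Binary.Construct.Closure.ReflexiveTransitive using (Star)
open import Relation.Binary.Construct.Closure.Transitive using (TransClosure)
open import Function.Bundles using (_⇔_)

record SimpleGraph (n : ℕ) : Set where
  field
    adj     : Fin n → Fin n → Bool
    sym     : ∀ u v → adj u v ≡ adj v u
    irrefl  : ∀ u → adj u u ≡ false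

module _ {n : ℕ} (G : SimpleGraph n) where
  open SimpleGraph G

  Adj : Fin n → Fin n → Set
  Adj u v = adj u v ≡ true

  degree : Fin n → ℕ
  degree u = length (filterᵇ (adj u) (allFinL n))

  Connected : Set
  Connected = ∀ u v → Star Adj u v

  Edge : Set
  Edge = Σ[ a ∈ Fin n ] Σ[ b ∈ Fin n ] (a < b × Adj a b)

  data QVert : Set where
    edgeCopy : Edge → Fin 2 → QVert
    rVert    : (u : Fin n) → Fin (n ∸ degree u) → QVert

  HatV : Set
  HatV = Fin n ⊎ QVert

  E' : Fin n → QVert → Set
  E' p (edgeCopy (a , b , _) j) = (p ≡ a) ⊎ (p ≡ b)
  E' p (rVert u i)              = p ≡ u

  HatPQ : Fin n → Fin n → QVert → Set
  HatPQ w p q = E' p q ⊎ (p ≡ w)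

  HatAdj : Fin n → HatV → HatV → Set
  HatAdj w (inj₁ p) (inj₁ p') = ⊥
  HatAdj w (inj₁ p) (inj₂ q)  = HatPQ w p q
  HatAdj w (inj₂ q) (inj₁ p)  = HatPQ w p q
  HatAdj w (inj₂ q) (inj₂ q') = ⊥

  CompAdj : Fin n → HatV → HatV → Set
  CompAdj w (inj₁ p) (inj₁ p') = p ≢ p'
  CompAdj w (inj₂ q) (inj₂ q') = q ≢ q'
  CompAdj w x y                = HatAdj w x y

Acyclic : {V : Set} → (V → V → Set) → Set
Acyclic {V} A = ∀ (x : V) → ¬ TransClosure A x x

MoralAdj : {V : Set} → (V → V → Set) → V → V → Set
MoralAdj {V} A u v =
  (u ≢ v) × (A u v ⊎ A v u ⊎ Σ[ c ∈ V ] (A u c × A v c))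

IsMoral : {V : Set} → (V → V → Set) → Set₁
IsMoral {V} H = Σ[ A ∈ (V → V → Set) ] (Acyclic A × (∀ u v → H u v ⇔ MoralAdj A u v))

-- Orient C(Ĝ) as follows: P along the order of Fin n, each edge pq of Ĝ from p to q, and
-- every other vertex of Q towards one fixed vertex q₀ ∈ R(w), which exists since d_G(w) < |V|.
-- Marrying the parents of q₀ makes Q a clique; the only parent of q₀ in P is w, its unique
-- neighbour in Ĝ, and since w is adjacent to all of Q this adds no edge between P and Q.
-- The orientation increases the rank toℕ p on P, |V| on Q ∖ {q₀} and |V| + 1 at q₀, so it is
-- acyclic.
module Submission where

open import Defs
open import Data.Nat using (ℕ; suc; _∸_; _<_; _≤_)
open import Data.Nat.Properties using (<-trans; <-irrefl; <-≤-trans; ≤-refl; n≤1+n; m<n⇒0<n∸m)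
open import Data.Fin as Fin using (Fin; toℕ; fromℕ<)
open import Data.Fin.Properties using (toℕ<n; <-cmp)
open import Data.Bool using (T; if_then_else_)
open import Data.List using (allFin)
open import Data.List.Properties using (filter-notAll; length-tabulate)
import Data.List.Relation.Unary.Any as Any
open import Data.List.Membership.Propositional.Properties using (∈-allFin)
open import Data.Product using (_×_; _,_)
open import Data.Sum using (_⊎_; inj₁; inj₂)
open import Data.Sum.Properties using (inj₁-injective; inj₂-injective)
open import Function using (_∘_)
open import Data.Empty using (⊥; ⊥-elim)
open import Relation.Nullary using (Dec; yes; no; does)
open import Relation.Nullary.Decidable using (T?; dec-true; dec-false)
open import Relation.Binary using (Tri; tri<; tri≈; tri>)
open import Relation.Binary.PropositionalEquality using (_≡_; _≢_; refl; subst; cong)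
open import Relation.Binary.Construct.Closure.Transitive using (TransClosure; [_]; _∷_)
open import Function.Bundles using (_⇔_; mk⇔)
open import Function.Construct.Identity using (⇔-id)
open import Function.Construct.Composition using (_⇔-∘_)

acyclic-by-rank : {V : Set} {A : V → V → Set} (rank : V → ℕ) →
                  (∀ x y → A x y → rank x < rank y) → Acyclic A
acyclic-by-rank {A = A} rank increasing x cycle = <-irrefl refl (rank-increases cycle)
  where
  rank-increases : ∀ {x y} → TransClosure A x y → rank x < rank y
  rank-increases [ a ]     = increasing _ _ a
  rank-increases (a ∷ as) = <-trans (increasing _ _ a) (rank-increases as)

IsMoral-resp-⇔ : {V : Set} {H H′ : V → V → Set} →
                 (∀ u v → H u v ⇔ H′ u v) → IsMoral H′ → IsMoral H
IsMoral-resp-⇔ H⇔H′ (A , acyclic , H′⇔moral) =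
  A , acyclic , λ u v → H′⇔moral u v ⇔-∘ H⇔H′ u v

module PartitionCompletion {m : ℕ} {Q : Set} (H : Fin m → Q → Set) where

  V : Set
  V = Fin m ⊎ Q

  Completion : V → V → Set
  Completion (inj₁ p) (inj₁ p′) = p ≢ p′
  Completion (inj₁ p) (inj₂ q)  = H p q
  Completion (inj₂ q) (inj₁ p)  = H p q
  Completion (inj₂ q) (inj₂ q′) = q ≢ q′

  module _ (q₀ : Q) (_≟q₀ : ∀ q → Dec (q ≡ q₀))
           (q₀-nbrs-universal : ∀ {p q} → H p q₀ → H p q) where

    Arc : V → V → Set
    Arc (inj₁ p) (inj₁ p′) = p Fin.< p′
    Arc (inj₁ p) (inj₂ q)  = H p q
    Arc (inj₂ q) (inj₁ p)  = ⊥
    Arc (inj₂ q) (inj₂ q′) = q ≢ q₀ × q′ ≡ q₀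

    rank : V → ℕ
    rank (inj₁ p) = toℕ p
    rank (inj₂ q) = if does (q ≟q₀) then suc m else m

    m≤rank : ∀ q → m ≤ rank (inj₂ q)
    m≤rank q with q ≟q₀
    ... | yes _ = n≤1+n m
    ... | no _  = ≤-refl

    rank-increasing : ∀ x y → Arc x y → rank x < rank y
    rank-increasing (inj₁ p) (inj₁ p′) p<p′ = p<p′
    rank-increasing (inj₁ p) (inj₂ q)  _    = <-≤-trans (toℕ<n p) (m≤rank q)
    rank-increasing (inj₂ q) (inj₂ q₀) (q≢q₀ , refl)
      rewrite dec-false (q ≟q₀) q≢q₀ | dec-true (q₀ ≟q₀) refl = ≤-refl

    Arc-acyclic : Acyclic Arc
    Arc-acyclic = acyclic-by-rank rank rank-increasing

    moral-PP : ∀ p p′ → p ≢ p′ → MoralAdj Arc (inj₁ p) (inj₁ p′)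
    moral-PP p p′ p≢p′ = p≢p′ ∘ inj₁-injective , arcs (<-cmp p p′)
      where
      arcs : Tri (p Fin.< p′) (p ≡ p′) (p′ Fin.< p) → _
      arcs (tri< p<p′ _ _) = inj₁ p<p′
      arcs (tri≈ _ p≡p′ _) = ⊥-elim (p≢p′ p≡p′)
      arcs (tri> _ _ p′<p) = inj₂ (inj₁ p′<p)

    moral-QQ : ∀ q q′ → q ≢ q′ → MoralAdj Arc (inj₂ q) (inj₂ q′)
    moral-QQ q q′ q≢q′ = q≢q′ ∘ inj₂-injective , arcs (q ≟q₀) (q′ ≟q₀)
      where
      arcs : Dec (q ≡ q₀) → Dec (q′ ≡ q₀) → _
      arcs (yes refl) (yes refl) = ⊥-elim (q≢q′ refl)
      arcs (yes refl) (no q′≢q₀) = inj₂ (inj₁ (q′≢q₀ , refl))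
      arcs (no q≢q₀) (yes refl)  = inj₁ (q≢q₀ , refl)
      arcs (no q≢q₀) (no q′≢q₀)  = inj₂ (inj₂ (inj₂ q₀ , (q≢q₀ , refl) , (q′≢q₀ , refl)))

    -- The only child of a vertex of Q is q₀.
    common-child-PQ : ∀ p q c → Arc (inj₁ p) c → Arc (inj₂ q) c → H p q
    common-child-PQ p q (inj₂ _) p→q₀ (_ , refl) = q₀-nbrs-universal p→q₀

    Completion⇔MoralAdj : ∀ u v → Completion u v ⇔ MoralAdj Arc u v
    Completion⇔MoralAdj (inj₁ p) (inj₁ p′) =
      mk⇔ (moral-PP p p′) (λ (x≢y , _) → x≢y ∘ cong inj₁)
    Completion⇔MoralAdj (inj₂ q) (inj₂ q′) =
      mk⇔ (moral-QQ q q′) (λ (x≢y , _) → x≢y ∘ cong inj₂)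
    Completion⇔MoralAdj (inj₁ p) (inj₂ q) = mk⇔ (λ h → (λ ()) , inj₁ h) moral⇒H
      where
      moral⇒H : MoralAdj Arc (inj₁ p) (inj₂ q) → H p q
      moral⇒H (_ , inj₁ h)                     = h
      moral⇒H (_ , inj₂ (inj₂ (c , p→c , q→c))) = common-child-PQ p q c p→c q→c
    Completion⇔MoralAdj (inj₂ q) (inj₁ p) = mk⇔ (λ h → (λ ()) , inj₂ (inj₁ h)) moral⇒H
      where
      moral⇒H : MoralAdj Arc (inj₂ q) (inj₁ p) → H p q
      moral⇒H (_ , inj₂ (inj₁ h))              = h
      moral⇒H (_ , inj₂ (inj₂ (c , q→c , p→c))) = common-child-PQ p q c p→c q→c

    Completion-isMoral : IsMoral Completion
    Completion-isMoral = Arc , Arc-acyclic , Completion⇔MoralAdj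

module _ {n : ℕ} (G : SimpleGraph n) where
  open SimpleGraph G

  degree<n : ∀ u → degree G u < n
  degree<n u = subst (degree G u <_) (length-tabulate {n = n} (λ x → x))
    (filter-notAll (λ v → T? (adj u v)) (allFin n)
      (Any.map (λ { refl u~u → subst T (irrefl u) u~u }) (∈-allFin u)))

  ≟-rVert : ∀ {u} i (q : QVert G) → Dec (q ≡ rVert u i)
  ≟-rVert i (edgeCopy _ _) = no (λ ())
  ≟-rVert {u} i (rVert u′ i′) with u′ Fin.≟ u
  ... | no u′≢u = no (λ { refl → u′≢u refl })
  ... | yes refl with i′ Fin.≟ i
  ...   | yes refl  = yes refl
  ...   | no i′≢i   = no (λ { refl → i′≢i refl })

  CompAdj⇔Completion : ∀ w x y → CompAdj G w x y ⇔ PartitionCompletion.Completion (HatPQ G w) x y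
  CompAdj⇔Completion w (inj₁ _) (inj₁ _) = ⇔-id _
  CompAdj⇔Completion w (inj₁ _) (inj₂ _) = ⇔-id _
  CompAdj⇔Completion w (inj₂ _) (inj₁ _) = ⇔-id _
  CompAdj⇔Completion w (inj₂ _) (inj₂ _) = ⇔-id _

lemma4 : (n : ℕ) (G : SimpleGraph n) → Connected G → (w : Fin n) →
    IsMoral (CompAdj G w)
lemma4 n G _ w =
  IsMoral-resp-⇔ (CompAdj⇔Completion G w)
    (Completion-isMoral q₀ (≟-rVert G i₀) only-w-sees-q₀)
  where
  open PartitionCompletion (HatPQ G w)
  i₀ : Fin (n ∸ degree G w)
  i₀ = fromℕ< (m<n⇒0<n∸m (degree<n G w))
  q₀ : QVert G
  q₀ = rVert w i₀
  only-w-sees-q₀ : ∀ {p q} → HatPQ G w p q₀ → HatPQ G w p q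
  only-w-sees-q₀ (inj₁ p≡w) = inj₂ p≡w
  only-w-sees-q₀ (inj₂ p≡w) = inj₂ p≡w
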